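{- Let $f(t)$ be a delta series with complex coefficients, let $\bar f(t)$ be its compositional inverse, and write $e^{\bar{f}(t)}=\sum_{n=0}^{\infty}p_{n}\frac{t^{n}}{n!}$. For all integers $n \ge k \ge 0$, \[ B_{n,k}\Big(\frac{p_{2}}{2},\frac{p_{3}}{3},\dots,\frac{p_{n-k+2}}{n-k+2}\Big) =\sum_{j=0}^{k}\binom{n+k}{k-j}\frac{n!}{(n+k)!}\,(-p_{1})^{k-j}\,S_{2}(n+j,j; f(t)). \]
   Context: All series are formal power series in $t$ over $\mathbb{C}$. A delta series is a formal power series $f(t)$ with $f(0)=0$, $f'(0)\neq0$; its compositional inverse $\bar f(t)$ satisfies $f(\bar f(t))=t=\bar f(f(t))$ and is again a delta series. The Stirling numbers of the second kind associated with $f$ are defined by $\frac{1}{k!}\big(e^{\bar f(t)}-1\big)^k=\sum_{n\ge k}S_2(n,k;f(t))\frac{t^n}{n!}$ for $k\ge0$. The partial Bell polynomials $B_{n,k}$ are defined by $\frac{1}{k!}\big(\sum_{m\ge1}x_m\frac{t^m}{m!}\big)^k=\sum_{n\ge k}B_{n,k}(x_1,\dots,x_{n-k+1})\frac{t^n}{n!}$. -}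

module Defs where

open import Level using (Level)
open import Data.Nat as ℕ using (ℕ; zero; suc; _∸_)
open import Data.Nat.Combinatorics using (_C_)
open import Algebra.Bundles using (CommutativeRing)
open import Relation.Nullary using (¬_)

-- Everything is parametrised by a commutative ring R (playing the role of ℂ)
-- together with a function inv with inv m = 1/(m+1) (see hypothesis in Statement).
module FPS {c ℓ : Level} (R : CommutativeRing c ℓ) (inv : ℕ → CommutativeRing.Carrier R) where
  open CommutativeRing R

  Series : Set c
  Series = ℕ → Carrier

  _≋_ : Series → Series → Set ℓ
  a ≋ b = ∀ n → a n ≈ b n

  sumTo : ℕ → (ℕ → Carrier) → Carrier
  sumTo zero    g = g 0
  sumTo (suc n) g = sumTo n g + g (suc n)

  cast : ℕ → Carrier
  cast zero    = 0#
  cast (suc n) = 1# + cast n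

  pw : Carrier → ℕ → Carrier
  pw x zero    = 1#
  pw x (suc k) = x * pw x k

  invFact : ℕ → Carrier
  invFact zero    = 1#
  invFact (suc k) = invFact k * inv k

  oneS : Series
  oneS zero    = 1#
  oneS (suc _) = 0#

  X : Series
  X 1 = 1#
  X _ = 0#

  mul : Series → Series → Series
  mul a b n = sumTo n (λ i → a i * b (n ∸ i))

  powS : Series → ℕ → Series
  powS a zero    = oneS
  powS a (suc k) = mul a (powS a k)

  -- composition g(h(t)), meaningful when h(0) = 0
  compose : Series → Series → Series
  compose g h n = sumTo n (λ k → g k * powS h k n)

  IsDelta : Series → Set ℓ
  IsDelta f = (f 0 ≈ 0#) × (¬ (f 1 ≈ 0#))
    where open import Data.Product using (_×_)

  -- fbar is a compositional inverse of f (fbar(0)=0 so that f(fbar(t)) is defined)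
  IsCompInverse : Series → Series → Set ℓ
  IsCompInverse f fbar = (fbar 0 ≈ 0#) × (compose f fbar ≋ X) × (compose fbar f ≋ X)
    where open import Data.Product using (_×_)

  -- exp(g(t)) = Σ_k g(t)^k / k!, for g(0) = 0
  expS : Series → Series
  expS g n = sumTo n (λ k → invFact k * powS g k n)

  expm1 : Series → Series
  expm1 g n = expS g n - oneS n

  pCoeff : Series → ℕ → Carrier
  pCoeff fbar n = cast (n ℕ.!) * expS fbar n

  -- S_2(n,k; f(t)) : (1/k!) (e^{fbar(t)} - 1)^k = Σ_n S_2(n,k;f) t^n/n!
  -- (defined via the inverse fbar of f)
  S2 : Series → ℕ → ℕ → Carrier
  S2 fbar n k = cast (n ℕ.!) * (invFact k * powS (expm1 fbar) k n)

  -- partial Bell polynomial B_{n,k}(x_1, x_2, ...), x given as a sequence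
  -- (x 0 unused): (1/k!)(Σ_{m≥1} x_m t^m/m!)^k = Σ_n B_{n,k} t^n/n!
  egfOf : (ℕ → Carrier) → Series
  egfOf x zero    = 0#
  egfOf x (suc m) = x (suc m) * invFact (suc m)

  bell : ℕ → ℕ → (ℕ → Carrier) → Carrier
  bell n k x = cast (n ℕ.!) * (invFact k * powS (egfOf x) k n)

-- Put D = e^f̄ − 1, so that D(0) = 0. The exponential generating function
-- Σ_{m≥1} (p_{m+1}/(m+1)) t^m/m! = Σ_{m≥1} p_{m+1} t^m/(m+1)! of the arguments of B_{n,k} is
-- A(t) − p₁ with A(t) = D(t)/t. Expanding (A − p₁)^k by the binomial theorem and taking the
-- coefficient of t^n gives Σ_j C(k,j) (−p₁)^{k−j} [t^n] A^j, and [t^n] A^j = [t^{n+j}] D^j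
-- = j! S₂(n+j, j)/(n+j)!. The coefficients agree because
-- C(k,j)/k! = 1/(j! (k−j)!) = C(n+k, k−j) (n+j)! / ((n+k)! j!).
module Submission where

open import Defs
open import Level using (Level)
open import Data.Nat as ℕ using (ℕ; zero; suc; _≤_; _<_; _∸_; _!; z≤n; s≤s)
open import Data.Nat.Combinatorics
  using (_C_; nCk≡n!/k![n-k]!; k![n∸k]!∣n!; k>n⇒nCk≡0; nCk+nC[k+1]≡[n+1]C[k+1])
open import Data.Nat.DivMod using (m/n*n≡m)
import Data.Nat.Properties as ℕₚ
open import Data.Sum using (_⊎_; inj₁; inj₂)
open import Algebra.Bundles using (CommutativeRing)
import Algebra.Properties.CommutativeSemigroup as CommutativeSemigroupProperties
import Algebra.Properties.Group as GroupProperties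
import Algebra.Solver.CommutativeMonoid as CommutativeMonoidSolver
open import Relation.Binary.PropositionalEquality as ≡ using (_≡_)

nCk*[k!*[n∸k]!]≡n! : ∀ {n k} → k ≤ n → (n C k) ℕ.* (k ! ℕ.* (n ∸ k) !) ≡ n !
nCk*[k!*[n∸k]!]≡n! {n} {k} k≤n = ≡.trans
  (≡.cong (ℕ._* (k ! ℕ.* (n ∸ k) !)) (nCk≡n!/k![n-k]! k≤n))
  (m/n*n≡m {{ℕₚ._!*_!≢0 k (n ∸ k)}} (k![n∸k]!∣n! k≤n))

module SeriesAlgebra {c ℓ : Level} (R : CommutativeRing c ℓ) (inv : ℕ → CommutativeRing.Carrier R) where
  open CommutativeRing R
  open FPS R inv
  open CommutativeSemigroupProperties *-commutativeSemigroup
    using (interchange; x∙yz≈y∙xz; xy∙z≈y∙xz)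
  open CommutativeSemigroupProperties +-commutativeSemigroup
    using () renaming (interchange to +-interchange; x∙yz≈y∙xz to +-x∙yz≈y∙xz)
  open GroupProperties +-group using (ε⁻¹≈ε)
  open CommutativeMonoidSolver *-commutativeMonoid using (solve; _⊕_; _⊜_)
  open import Relation.Binary.Reasoning.Setoid setoid

  sumTo-cong : ∀ n {g h : ℕ → Carrier} → (∀ i → i ≤ n → g i ≈ h i) → sumTo n g ≈ sumTo n h
  sumTo-cong zero    g≈h = g≈h 0 z≤n
  sumTo-cong (suc n) g≈h =
    +-cong (sumTo-cong n (λ i i≤n → g≈h i (ℕₚ.m≤n⇒m≤1+n i≤n))) (g≈h (suc n) ℕₚ.≤-refl)

  sumTo-zero : ∀ n {g : ℕ → Carrier} → (∀ i → i ≤ n → g i ≈ 0#) → sumTo n g ≈ 0#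
  sumTo-zero zero    g≈0 = g≈0 0 z≤n
  sumTo-zero (suc n) g≈0 = trans
    (+-cong (sumTo-zero n (λ i i≤n → g≈0 i (ℕₚ.m≤n⇒m≤1+n i≤n))) (g≈0 (suc n) ℕₚ.≤-refl))
    (+-identityʳ 0#)

  sumTo-+ : ∀ n (g h : ℕ → Carrier) → sumTo n (λ i → g i + h i) ≈ sumTo n g + sumTo n h
  sumTo-+ zero    g h = refl
  sumTo-+ (suc n) g h = trans (+-congʳ (sumTo-+ n g h)) (+-interchange _ _ _ _)

  *-distribˡ-sumTo : ∀ n x (g : ℕ → Carrier) → x * sumTo n g ≈ sumTo n (λ i → x * g i)
  *-distribˡ-sumTo zero    x g = refl
  *-distribˡ-sumTo (suc n) x g = trans (distribˡ x _ _) (+-congʳ (*-distribˡ-sumTo n x g))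

  sumTo-suc : ∀ n (g : ℕ → Carrier) → sumTo (suc n) g ≈ g 0 + sumTo n (λ i → g (suc i))
  sumTo-suc zero    g = refl
  sumTo-suc (suc n) g = trans (+-congʳ (sumTo-suc n g)) (+-assoc _ _ _)

  sumTo-comm : ∀ n k (F : ℕ → ℕ → Carrier) →
    sumTo n (λ i → sumTo k (F i)) ≈ sumTo k (λ j → sumTo n (λ i → F i j))
  sumTo-comm zero    k F = refl
  sumTo-comm (suc n) k F = trans (+-congʳ (sumTo-comm n k F)) (sym (sumTo-+ k _ _))

  sumTo-truncate : ∀ {n} m → n ≤ m → {g : ℕ → Carrier} →
    (∀ i → n < i → i ≤ m → g i ≈ 0#) → sumTo m g ≈ sumTo n g
  sumTo-truncate zero    z≤n g≈0 = refl
  sumTo-truncate (suc m) n≤1+m g≈0 with ℕₚ.m≤n⇒m<n∨m≡n n≤1+m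
  ... | inj₂ ≡.refl       = refl
  ... | inj₁ (s≤s n≤m) = trans
    (+-cong (sumTo-truncate m n≤m (λ i n<i i≤m → g≈0 i n<i (ℕₚ.m≤n⇒m≤1+n i≤m)))
            (g≈0 (suc m) (s≤s n≤m) ℕₚ.≤-refl))
    (+-identityʳ _)

  cast-+ : ∀ a b → cast (a ℕ.+ b) ≈ cast a + cast b
  cast-+ zero    b = sym (+-identityˡ _)
  cast-+ (suc a) b = trans (+-congˡ (cast-+ a b)) (sym (+-assoc _ _ _))

  cast-* : ∀ a b → cast (a ℕ.* b) ≈ cast a * cast b
  cast-* zero    b = sym (zeroˡ _)
  cast-* (suc a) b = begin
    cast (b ℕ.+ a ℕ.* b)          ≈⟨ cast-+ b (a ℕ.* b) ⟩
    cast b + cast (a ℕ.* b)       ≈⟨ +-cong (sym (*-identityˡ _)) (cast-* a b) ⟩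
    1# * cast b + cast a * cast b ≈⟨ distribʳ _ _ _ ⟨
    cast (suc a) * cast b         ∎

  x-0#≈x : ∀ x → x - 0# ≈ x
  x-0#≈x x = trans (+-congˡ ε⁻¹≈ε) (+-identityʳ x)

  expm1-0 : ∀ g → expm1 g 0 ≈ 0#
  expm1-0 g = trans (+-congʳ (*-identityˡ 1#)) (-‿inverseʳ 1#)

  shift : Series → Series
  shift h m = h (suc m)

  plusConst : Series → Carrier → Series
  plusConst a x n = a n + x * oneS n

  mul-cong : ∀ {a a′ b b′} → a ≋ a′ → b ≋ b′ → mul a b ≋ mul a′ b′
  mul-cong a≋a′ b≋b′ n = sumTo-cong n (λ i _ → *-cong (a≋a′ i) (b≋b′ (n ∸ i)))

  powS-cong : ∀ {a b} → a ≋ b → ∀ k → powS a k ≋ powS b k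
  powS-cong a≋b zero    n = refl
  powS-cong a≋b (suc k)   = mul-cong a≋b (powS-cong a≋b k)

  mul-oneSˡ : ∀ b n → mul oneS b n ≈ b n
  mul-oneSˡ b zero    = *-identityˡ _
  mul-oneSˡ b (suc n) = begin
    sumTo (suc n) (λ i → oneS i * b (suc n ∸ i))    ≈⟨ sumTo-suc n _ ⟩
    1# * b (suc n) + sumTo n (λ i → 0# * b (n ∸ i)) ≈⟨ +-cong (*-identityˡ _) (sumTo-zero n (λ i _ → zeroˡ _)) ⟩
    b (suc n) + 0#                                  ≈⟨ +-identityʳ _ ⟩
    b (suc n)                                       ∎

  mul-plusConstˡ : ∀ a x b n → mul (plusConst a x) b n ≈ mul a b n + x * b n
  mul-plusConstˡ a x b n = begin
    sumTo n (λ i → (a i + x * oneS i) * b (n ∸ i))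
      ≈⟨ sumTo-cong n (λ i _ → distribʳ _ _ _) ⟩
    sumTo n (λ i → a i * b (n ∸ i) + (x * oneS i) * b (n ∸ i))
      ≈⟨ sumTo-+ n _ _ ⟩
    mul a b n + sumTo n (λ i → (x * oneS i) * b (n ∸ i))
      ≈⟨ +-congˡ (sumTo-cong n (λ i _ → *-assoc _ _ _)) ⟩
    mul a b n + sumTo n (λ i → x * (oneS i * b (n ∸ i)))
      ≈⟨ +-congˡ (*-distribˡ-sumTo n x _) ⟨
    mul a b n + x * mul oneS b n
      ≈⟨ +-congˡ (*-congˡ (mul-oneSˡ b n)) ⟩
    mul a b n + x * b n ∎

  mul-sumToʳ : ∀ k a (s : ℕ → Carrier) (F : ℕ → Series) n →
    mul a (λ m → sumTo k (λ j → s j * F j m)) n ≈ sumTo k (λ j → s j * mul a (F j) n)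
  mul-sumToʳ k a s F n = begin
    sumTo n (λ i → a i * sumTo k (λ j → s j * F j (n ∸ i)))
      ≈⟨ sumTo-cong n (λ i _ → *-distribˡ-sumTo k (a i) _) ⟩
    sumTo n (λ i → sumTo k (λ j → a i * (s j * F j (n ∸ i))))
      ≈⟨ sumTo-comm n k _ ⟩
    sumTo k (λ j → sumTo n (λ i → a i * (s j * F j (n ∸ i))))
      ≈⟨ sumTo-cong k (λ j _ → sumTo-cong n (λ i _ → x∙yz≈y∙xz _ _ _)) ⟩
    sumTo k (λ j → sumTo n (λ i → s j * (a i * F j (n ∸ i))))
      ≈⟨ sumTo-cong k (λ j _ → *-distribˡ-sumTo n (s j) _) ⟨
    sumTo k (λ j → s j * mul a (F j) n) ∎

  powS-vanishes : ∀ h → h 0 ≈ 0# → ∀ j m → m < j → powS h j m ≈ 0#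
  powS-vanishes h h0≈0 (suc j) m (s≤s m≤j) = sumTo-zero m summand≈0
    where
    summand≈0 : ∀ i → i ≤ m → h i * powS h j (m ∸ i) ≈ 0#
    summand≈0 zero    _      = trans (*-congʳ h0≈0) (zeroˡ _)
    summand≈0 (suc i) 1+i≤m = trans
      (*-congˡ (powS-vanishes h h0≈0 j (m ∸ suc i)
        (ℕₚ.<-≤-trans (ℕₚ.∸-monoʳ-< {m} {suc i} {0} (s≤s z≤n) 1+i≤m) m≤j)))
      (zeroʳ _)

  powS-shift : ∀ h → h 0 ≈ 0# → ∀ j n → powS h j (j ℕ.+ n) ≈ powS (shift h) j n
  powS-shift h h0≈0 zero    n = refl
  powS-shift h h0≈0 (suc j) n = begin
    sumTo (suc (j ℕ.+ n)) (λ i → h i * powS h j (suc (j ℕ.+ n) ∸ i))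
      ≈⟨ sumTo-suc (j ℕ.+ n) _ ⟩
    h 0 * powS h j (suc (j ℕ.+ n)) + sumTo (j ℕ.+ n) summand
      ≈⟨ +-congʳ (trans (*-congʳ h0≈0) (zeroˡ _)) ⟩
    0# + sumTo (j ℕ.+ n) summand
      ≈⟨ +-identityˡ _ ⟩
    sumTo (j ℕ.+ n) summand
      ≈⟨ sumTo-truncate (j ℕ.+ n) (ℕₚ.m≤n+m n j) (λ i n<i i≤j+n → trans
           (*-congˡ (powS-vanishes h h0≈0 j _
             (≡.subst (j ℕ.+ n ∸ i <_) (ℕₚ.m+n∸n≡m j n) (ℕₚ.∸-monoʳ-< n<i i≤j+n))))
           (zeroʳ _)) ⟩
    sumTo n summand
      ≈⟨ sumTo-cong n (λ i i≤n → *-congˡ (trans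
           (reflexive (≡.cong (powS h j) (ℕₚ.+-∸-assoc j i≤n)))
           (powS-shift h h0≈0 j (n ∸ i)))) ⟩
    sumTo n (λ i → h (suc i) * powS (shift h) j (n ∸ i)) ∎
    where
    summand : ℕ → Carrier
    summand i = h (suc i) * powS h j (j ℕ.+ n ∸ i)

  binomial : Carrier → ℕ → ℕ → Carrier
  binomial x k j = cast (k C j) * pw x (k ∸ j)

  binomial-vanishes : ∀ x k → binomial x k (suc k) ≈ 0#
  binomial-vanishes x k = trans (*-congʳ (reflexive (≡.cong cast (k>n⇒nCk≡0 (ℕₚ.n<1+n k))))) (zeroˡ _)

  binomial-pascal : ∀ x k j → binomial x (suc k) (suc j) ≈ binomial x k j + x * binomial x k (suc j)
  binomial-pascal x k j = begin
    cast (suc k C suc j) * pw x (k ∸ j)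
      ≈⟨ *-congʳ (reflexive (≡.cong cast (nCk+nC[k+1]≡[n+1]C[k+1] k j))) ⟨
    cast (k C j ℕ.+ k C suc j) * pw x (k ∸ j)
      ≈⟨ trans (*-congʳ (cast-+ (k C j) (k C suc j))) (distribʳ _ _ _) ⟩
    binomial x k j + cast (k C suc j) * pw x (k ∸ j)
      ≈⟨ +-congˡ (pw-step (ℕₚ.≤-<-connex (suc j) k)) ⟩
    binomial x k j + x * binomial x k (suc j) ∎
    where
    pw-step : suc j ≤ k ⊎ k < suc j →
      cast (k C suc j) * pw x (k ∸ j) ≈ x * (cast (k C suc j) * pw x (k ∸ suc j))
    pw-step (inj₁ j<k) = trans
      (*-congˡ (reflexive (≡.cong (pw x) (ℕₚ.+-∸-assoc 1 j<k))))
      (x∙yz≈y∙xz _ _ _)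
    pw-step (inj₂ k<1+j) rewrite k>n⇒nCk≡0 k<1+j =
      trans (zeroˡ _) (sym (trans (*-congˡ (zeroˡ _)) (zeroʳ x)))

  binomial-sumTo-suc : ∀ x k (X : ℕ → Carrier) →
    sumTo (suc k) (λ j → binomial x (suc k) j * X j)
      ≈ sumTo k (λ j → binomial x k j * X (suc j)) + x * sumTo k (λ j → binomial x k j * X j)
  binomial-sumTo-suc x k X = begin
    sumTo (suc k) (λ j → binomial x (suc k) j * X j)
      ≈⟨ sumTo-suc k _ ⟩
    B₀ + sumTo k (λ j → binomial x (suc k) (suc j) * X (suc j))
      ≈⟨ +-congˡ (sumTo-cong k (λ j _ → trans (*-congʳ (binomial-pascal x k j)) (distribʳ _ _ _))) ⟩
    B₀ + sumTo k (λ j → binomial x k j * X (suc j) + (x * binomial x k (suc j)) * X (suc j))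
      ≈⟨ +-congˡ (sumTo-+ k _ _) ⟩
    B₀ + (sumTo k (λ j → binomial x k j * X (suc j)) + Bₛ)
      ≈⟨ +-x∙yz≈y∙xz _ _ _ ⟩
    sumTo k (λ j → binomial x k j * X (suc j)) + (B₀ + Bₛ)
      ≈⟨ +-congˡ scaled ⟨
    sumTo k (λ j → binomial x k j * X (suc j)) + x * sumTo k (λ j → binomial x k j * X j) ∎
    where
    B₀ Bₛ : Carrier
    B₀ = binomial x (suc k) 0 * X 0
    Bₛ = sumTo k (λ j → (x * binomial x k (suc j)) * X (suc j))
    scaled : x * sumTo k (λ j → binomial x k j * X j) ≈ B₀ + Bₛ
    scaled = begin
      x * sumTo k (λ j → binomial x k j * X j)
        ≈⟨ *-distribˡ-sumTo k x _ ⟩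
      sumTo k (λ j → x * (binomial x k j * X j))
        ≈⟨ sumTo-cong k (λ j _ → *-assoc _ _ _) ⟨
      sumTo k (λ j → (x * binomial x k j) * X j)
        ≈⟨ +-identityʳ _ ⟨
      sumTo k (λ j → (x * binomial x k j) * X j) + 0#
        ≈⟨ +-congˡ (trans (*-congʳ (trans (*-congˡ (binomial-vanishes x k)) (zeroʳ x))) (zeroˡ _)) ⟨
      sumTo (suc k) (λ j → (x * binomial x k j) * X j)
        ≈⟨ sumTo-suc k _ ⟩
      (x * binomial x k 0) * X 0 + Bₛ
        ≈⟨ +-congʳ (*-congʳ (x∙yz≈y∙xz _ _ _)) ⟩
      B₀ + Bₛ ∎

  powS-plusConst : ∀ a x k n → powS (plusConst a x) k n ≈ sumTo k (λ j → binomial x k j * powS a j n)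
  powS-plusConst a x zero    n = sym (trans (*-congʳ (trans (*-identityʳ _) (+-identityʳ 1#))) (*-identityˡ _))
  powS-plusConst a x (suc k) n = begin
    mul (plusConst a x) (powS (plusConst a x) k) n
      ≈⟨ mul-cong (λ _ → refl) (powS-plusConst a x k) n ⟩
    mul (plusConst a x) Bₖ n
      ≈⟨ mul-plusConstˡ a x Bₖ n ⟩
    mul a Bₖ n + x * Bₖ n
      ≈⟨ +-congʳ (mul-sumToʳ k a (binomial x k) (powS a) n) ⟩
    sumTo k (λ j → binomial x k j * powS a (suc j) n) + x * Bₖ n
      ≈⟨ binomial-sumTo-suc x k (λ j → powS a j n) ⟨
    sumTo (suc k) (λ j → binomial x (suc k) j * powS a j n) ∎
    where
    Bₖ : Series
    Bₖ m = sumTo k (λ j → binomial x k j * powS a j m)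

  module _ (inv-correct : ∀ m → cast (suc m) * inv m ≈ 1#) where

    cast-!*invFact : ∀ a → cast (a !) * invFact a ≈ 1#
    cast-!*invFact zero    = trans (*-identityʳ _) (+-identityʳ 1#)
    cast-!*invFact (suc a) = begin
      cast (suc a ℕ.* a !) * (invFact a * inv a)          ≈⟨ *-congʳ (trans (cast-* (suc a) (a !)) (*-comm _ _)) ⟩
      (cast (a !) * cast (suc a)) * (invFact a * inv a)   ≈⟨ interchange _ _ _ _ ⟩
      (cast (a !) * invFact a) * (cast (suc a) * inv a)   ≈⟨ *-cong (cast-!*invFact a) (inv-correct a) ⟩
      1# * 1#                                             ≈⟨ *-identityʳ 1# ⟩
      1#                                                  ∎

    invFact*cast-C : ∀ {k j} → j ≤ k → invFact k * cast (k C j) ≈ invFact j * invFact (k ∸ j)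
    invFact*cast-C {k} {j} j≤k = begin
      invFact k * cast (k C j)
        ≈⟨ *-identityʳ _ ⟨
      (invFact k * cast (k C j)) * 1#
        ≈⟨ *-congˡ (trans (*-cong (cast-!*invFact j) (cast-!*invFact (k ∸ j))) (*-identityʳ 1#)) ⟨
      (invFact k * cast (k C j)) * ((cast (j !) * invFact j) * (cast ((k ∸ j) !) * invFact (k ∸ j)))
        ≈⟨ regroup _ _ _ _ _ _ ⟩
      (invFact k * (cast (k C j) * (cast (j !) * cast ((k ∸ j) !)))) * (invFact j * invFact (k ∸ j))
        ≈⟨ *-congʳ (*-congˡ (trans (cast-* (k C j) _) (*-congˡ (cast-* (j !) ((k ∸ j) !))))) ⟨
      (invFact k * cast ((k C j) ℕ.* (j ! ℕ.* (k ∸ j) !))) * (invFact j * invFact (k ∸ j))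
        ≈⟨ *-congʳ (*-congˡ (reflexive (≡.cong cast (nCk*[k!*[n∸k]!]≡n! j≤k)))) ⟩
      (invFact k * cast (k !)) * (invFact j * invFact (k ∸ j))
        ≈⟨ *-congʳ (trans (*-comm _ _) (cast-!*invFact k)) ⟩
      1# * (invFact j * invFact (k ∸ j))
        ≈⟨ *-identityˡ _ ⟩
      invFact j * invFact (k ∸ j) ∎
      where
      regroup : ∀ a b c d e f → (a * b) * ((c * d) * (e * f)) ≈ (a * (b * (c * e))) * (d * f)
      regroup = solve 6 (λ a b c d e f →
        ((a ⊕ b) ⊕ ((c ⊕ d) ⊕ (e ⊕ f))) ⊜ ((a ⊕ (b ⊕ (c ⊕ e))) ⊕ (d ⊕ f))) refl

    invFact*cast-C≈shifted : ∀ n {k j} → j ≤ k →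
      invFact k * cast (k C j)
        ≈ (invFact (n ℕ.+ k) * cast ((n ℕ.+ k) C (k ∸ j))) * (cast ((n ℕ.+ j) !) * invFact j)
    invFact*cast-C≈shifted n {k} {j} j≤k = begin
      invFact k * cast (k C j)
        ≈⟨ trans (invFact*cast-C j≤k) (*-comm _ _) ⟩
      invFact (k ∸ j) * invFact j
        ≈⟨ *-congʳ (*-identityʳ _) ⟨
      (invFact (k ∸ j) * 1#) * invFact j
        ≈⟨ *-congʳ (*-congˡ (trans (*-comm _ _) (cast-!*invFact (n ℕ.+ j)))) ⟨
      (invFact (k ∸ j) * (invFact (n ℕ.+ j) * cast ((n ℕ.+ j) !))) * invFact j
        ≈⟨ trans (*-assoc _ _ _) (*-congˡ (*-assoc _ _ _)) ⟩
      invFact (k ∸ j) * (invFact (n ℕ.+ j) * (cast ((n ℕ.+ j) !) * invFact j))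
        ≈⟨ *-assoc _ _ _ ⟨
      (invFact (k ∸ j) * invFact (n ℕ.+ j)) * (cast ((n ℕ.+ j) !) * invFact j)
        ≈⟨ *-congʳ (*-congˡ (reflexive (≡.cong invFact n+k∸[k∸j]≡n+j))) ⟨
      (invFact (k ∸ j) * invFact (n ℕ.+ k ∸ (k ∸ j))) * (cast ((n ℕ.+ j) !) * invFact j)
        ≈⟨ *-congʳ (invFact*cast-C k∸j≤n+k) ⟨
      (invFact (n ℕ.+ k) * cast ((n ℕ.+ k) C (k ∸ j))) * (cast ((n ℕ.+ j) !) * invFact j) ∎
      where
      k∸j≤n+k : k ∸ j ≤ n ℕ.+ k
      k∸j≤n+k = ℕₚ.≤-trans (ℕₚ.m∸n≤m k j) (ℕₚ.m≤n+m k n)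
      n+k∸[k∸j]≡n+j : n ℕ.+ k ∸ (k ∸ j) ≡ n ℕ.+ j
      n+k∸[k∸j]≡n+j = ≡.trans (ℕₚ.+-∸-assoc n (ℕₚ.m∸n≤m k j)) (≡.cong (n ℕ.+_) (ℕₚ.m∸[m∸n]≡n j≤k))

    pCoeff*invFact : ∀ g n → pCoeff g n * invFact n ≈ expS g n
    pCoeff*invFact g n = trans (xy∙z≈y∙xz _ _ _) (trans (*-congˡ (cast-!*invFact n)) (*-identityʳ _))

    egfOf-pCoeff : ∀ g → egfOf (λ m → pCoeff g (suc m) * inv m) ≋ plusConst (shift (expm1 g)) (- pCoeff g 1)
    egfOf-pCoeff g zero = sym (begin
      (expS g 1 - 0#) + (- pCoeff g 1) * 1# ≈⟨ +-cong (x-0#≈x _) (trans (*-identityʳ _) (-‿cong pCoeff₁)) ⟩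
      expS g 1 - expS g 1                   ≈⟨ -‿inverseʳ _ ⟩
      0#                                    ∎)
      where
      pCoeff₁ : pCoeff g 1 ≈ expS g 1
      pCoeff₁ = trans (*-congʳ (+-identityʳ 1#)) (*-identityˡ _)
    egfOf-pCoeff g (suc m) = begin
      (pCoeff g (2 ℕ.+ m) * inv (suc m)) * invFact (suc m)   ≈⟨ trans (*-assoc _ _ _) (*-congˡ (*-comm _ _)) ⟩
      pCoeff g (2 ℕ.+ m) * invFact (2 ℕ.+ m)                 ≈⟨ pCoeff*invFact g (2 ℕ.+ m) ⟩
      expS g (2 ℕ.+ m)                                       ≈⟨ +-identityʳ _ ⟨
      expS g (2 ℕ.+ m) + 0#                                  ≈⟨ +-cong (x-0#≈x _) (zeroʳ _) ⟨
      (expS g (2 ℕ.+ m) - 0#) + (- pCoeff g 1) * 0#          ∎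

    bell-summand : ∀ D → D 0 ≈ 0# → ∀ x n k j → j ≤ k →
      cast (n !) * (invFact k * (binomial x k j * powS (shift D) j n))
        ≈ cast ((n ℕ.+ k) C (k ∸ j)) * (cast (n !) * (invFact (n ℕ.+ k) *
            (pw x (k ∸ j) * (cast ((n ℕ.+ j) !) * (invFact j * powS D j (n ℕ.+ j))))))
    bell-summand D D0≈0 x n k j j≤k = begin
      cast (n !) * (invFact k * ((cast (k C j) * pw x (k ∸ j)) * powS (shift D) j n))
        ≈⟨ regroupˡ _ _ _ _ _ ⟩
      (invFact k * cast (k C j)) * (cast (n !) * (pw x (k ∸ j) * powS (shift D) j n))
        ≈⟨ *-congʳ (invFact*cast-C≈shifted n j≤k) ⟩
      ((invFact (n ℕ.+ k) * cast ((n ℕ.+ k) C (k ∸ j))) * (cast ((n ℕ.+ j) !) * invFact j))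
        * (cast (n !) * (pw x (k ∸ j) * powS (shift D) j n))
        ≈⟨ regroupʳ _ _ _ _ _ _ _ ⟩
      cast ((n ℕ.+ k) C (k ∸ j)) * (cast (n !) * (invFact (n ℕ.+ k) *
        (pw x (k ∸ j) * (cast ((n ℕ.+ j) !) * (invFact j * powS (shift D) j n)))))
        ≈⟨ *-congˡ (*-congˡ (*-congˡ (*-congˡ (*-congˡ (*-congˡ shifted))))) ⟩
      cast ((n ℕ.+ k) C (k ∸ j)) * (cast (n !) * (invFact (n ℕ.+ k) *
        (pw x (k ∸ j) * (cast ((n ℕ.+ j) !) * (invFact j * powS D j (n ℕ.+ j)))))) ∎
      where
      shifted : powS (shift D) j n ≈ powS D j (n ℕ.+ j)
      shifted = sym (trans (reflexive (≡.cong (powS D j) (ℕₚ.+-comm n j))) (powS-shift D D0≈0 j n))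
      regroupˡ : ∀ a b c d e → a * (b * ((c * d) * e)) ≈ (b * c) * (a * (d * e))
      regroupˡ = solve 5 (λ a b c d e → (a ⊕ (b ⊕ ((c ⊕ d) ⊕ e))) ⊜ ((b ⊕ c) ⊕ (a ⊕ (d ⊕ e)))) refl
      regroupʳ : ∀ a b c d e f g → ((a * b) * (c * d)) * (e * (f * g)) ≈ b * (e * (a * (f * (c * (d * g)))))
      regroupʳ = solve 7 (λ a b c d e f g →
        (((a ⊕ b) ⊕ (c ⊕ d)) ⊕ (e ⊕ (f ⊕ g))) ⊜ (b ⊕ (e ⊕ (a ⊕ (f ⊕ (c ⊕ (d ⊕ g))))))) refl

open import Data.Nat using (_+_)

lemma2p3 : {c ℓ : Level} (R : CommutativeRing c ℓ) (inv : ℕ → CommutativeRing.Carrier R)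
    → (∀ m → CommutativeRing._≈_ R (CommutativeRing._*_ R (FPS.cast R inv (suc m)) (inv m)) (CommutativeRing.1# R))
    → (f fbar : FPS.Series R inv)
    → FPS.IsDelta R inv f
    → FPS.IsCompInverse R inv f fbar
    → (n k : ℕ) → k ≤ n
    → CommutativeRing._≈_ R
        (FPS.bell R inv n k (λ m → CommutativeRing._*_ R (FPS.pCoeff R inv fbar (suc m)) (inv m)))
        (FPS.sumTo R inv k (λ j →
          CommutativeRing._*_ R (FPS.cast R inv ((n + k) C (k ∸ j)))
          (CommutativeRing._*_ R (FPS.cast R inv (n ℕ.!))
          (CommutativeRing._*_ R (FPS.invFact R inv (n + k))
          (CommutativeRing._*_ R (FPS.pw R inv (CommutativeRing.-_ R (FPS.pCoeff R inv fbar 1)) (k ∸ j))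
            (FPS.S2 R inv fbar (n + j) j))))))
lemma2p3 R inv inv-correct _ fbar _ _ n k _ = begin
    cast (n !) * (invFact k * powS (egfOf x) k n)
  ≈⟨ *-congˡ (*-congˡ (trans (powS-cong (egfOf-pCoeff inv-correct fbar) k n) (powS-plusConst _ _ k n))) ⟩
    cast (n !) * (invFact k * sumTo k (λ j → binomial c₀ k j * powS (shift D) j n))
  ≈⟨ trans (*-congˡ (*-distribˡ-sumTo k _ _)) (*-distribˡ-sumTo k _ _) ⟩
    sumTo k (λ j → cast (n !) * (invFact k * (binomial c₀ k j * powS (shift D) j n)))
  ≈⟨ sumTo-cong k (bell-summand inv-correct D (expm1-0 fbar) c₀ n k) ⟩
    sumTo k (λ j → cast ((n + k) C (k ∸ j)) * (cast (n !) * (invFact (n + k) * (pw c₀ (k ∸ j) * S2 fbar (n + j) j)))) ∎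
  where
  open CommutativeRing R hiding (_+_)
  open FPS R inv
  open SeriesAlgebra R inv
  open import Relation.Binary.Reasoning.Setoid setoid
  x : ℕ → Carrier
  x m = pCoeff fbar (suc m) * inv m
  c₀ : Carrier
  c₀ = - pCoeff fbar 1
  D : Series
  D = expm1 fbar
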